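{- Let $c,L$ be positive integers and $\phi^*\in\Phi_{c,4}$. For every positive integer $\ell$, there exist $\epsilon>0$ and $r_0\in\mathbb{N}$ such that, for every integer $r\ge r_0$ and every $\ell$-periodic string $s=s_1,\ldots,s_{2r}\in\Sigma^{2r}$ with $\tau(s)\le\epsilon r$, the graph $G_{n_s}$ contains a path $v_1,\ldots,v_{2m}$ ($m\ge1$) such that $\phi_s(v_1),\ldots,\phi_s(v_{2m})$ is anagramish.
   Context: $G_n$ is the $2\times n$ grid: vertices $a_0,\ldots,a_{n-1},b_0,\ldots,b_{n-1}$, edges $a_ia_{i+1}$, $b_ib_{i+1}$ and $a_ib_i$. $\Phi_{c,n}$ is the set of all functions $V(G_n)\to\{1,\ldots,c\}$. Let $\Sigma:=\{(k,\phi): k\in\{1,\ldots,L\},\ \phi\in\Phi_{c,4k}\}$ (a finite alphabet). For $s=(k_1,\phi_1),\ldots,(k_q,\phi_q)\in\Sigma^q$ let $n_{s,i}:=4(i+\sum_{j=1}^i k_j)$ for $0\le i\le q$ and $n_s:=n_{s,q}$. The colouring $\phi_s$ of $G_{n_s}$ is: for each $i\in\{0,\ldots,q-1\}$ and $t\in\{0,1,2,3\}$, $\phi_s(a_{n_{s,i}+t}):=\phi^*(a_t)$, $\phi_s(b_{n_{s,i}+t}):=\phi^*(b_t)$ ("boring blocks"); and for each $i\in\{1,\ldots,q\}$ and $t\in\{0,\ldots,4k_i-1\}$, $\phi_s(a_{n_{s,i-1}+4+t}):=\phi_i(a_t)$, $\phi_s(b_{n_{s,i-1}+4+t}):=\phi_i(b_t)$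 ("colourful blocks"). For a string $u=u_1,\ldots,u_{2r}$ over $\Sigma$ and $a\in\Sigma$, $\mathrm{hist}_a$ counts occurrences of $a$, $\tau_a(u):=|\mathrm{hist}_a(u_1,\ldots,u_r)-\mathrm{hist}_a(u_{r+1},\ldots,u_{2r})|$ and $\tau(u):=\sum_{a}\tau_a(u)$. A string is $\ell$-periodic if every length-$\ell$ substring of consecutive entries contains every character appearing in the string. A string $w_1,\ldots,w_{2m}$ is anagramish if $w_1,\ldots,w_m$ is a permutation of $w_{m+1},\ldots,w_{2m}$. -}

module Defs where

open import Data.Nat using (ℕ; zero; suc; _+_; _*_; _≤_; ∣_-_∣)
open import Data.Nat.Properties using (*-distribˡ-+; +-assoc)
open import Data.Fin using (Fin; toℕ; cast)
import Data.Fin.Properties as FinP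
open import Data.Vec using (Vec; []; _∷_; lookup)
import Data.Vec.Properties as VecP
open import Data.List using (List; []; _∷_; length; map; concatMap; concat; tabulate; allFin; cartesianProduct; filter; take; drop; _++_)
open import Data.Nat.ListAction using (sum)
import Data.List as L
open import Data.List.Properties using (length-++; length-tabulate)
open import Data.List.Membership.Propositional using (_∈_)
open import Data.List.Relation.Unary.Unique.Propositional using (Unique)
open import Data.List.Relation.Binary.Permutation.Propositional using (_↭_)
open import Data.Product using (Σ; _×_; _,_; proj₁; proj₂)
import Data.Product.Properties as ProdP
open import Relation.Binary.PropositionalEquality using (_≡_; refl; cong; cong₂; trans)
open import Data.Nat.Solver using (module +-*-Solver)
open +-*-Solver using (solve; _:+_; _:*_; con; _:=_)
open import Relation.Binary.Definitions using (DecidableEquality)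

data Vertex (n : ℕ) : Set where
  a : Fin n → Vertex n
  b : Fin n → Vertex n

Adj : {n : ℕ} → Vertex n → Vertex n → Set
Adj (a i) (a j) = Σ (toℕ j ≡ suc (toℕ i) Data.Sum.⊎ toℕ i ≡ suc (toℕ j)) (λ _ → Data.Unit.⊤)
  where import Data.Sum ; import Data.Unit
Adj (b i) (b j) = Σ (toℕ j ≡ suc (toℕ i) Data.Sum.⊎ toℕ i ≡ suc (toℕ j)) (λ _ → Data.Unit.⊤)
  where import Data.Sum ; import Data.Unit
Adj (a i) (b j) = i ≡ j
Adj (b i) (a j) = i ≡ j

Walk : {n : ℕ} → List (Vertex n) → Set
Walk [] = Data.Unit.⊤  where import Data.Unit
Walk (v ∷ []) = Data.Unit.⊤  where import Data.Unit
Walk (v ∷ w ∷ vs) = Adj v w × Walk (w ∷ vs)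

IsPath : {n : ℕ} → List (Vertex n) → Set
IsPath vs = Walk vs × Unique vs

-- Colourings.  Colours {1,…,c} are represented by Fin c (colour t+1 ↦ t).
-- Φ c n = all functions V(G_n) → {1..c}.

Φ : ℕ → ℕ → Set
Φ c n = Vertex n → Fin c

-- For the alphabet Σ we need decidable equality / finite enumeration of
-- colourings, so a colouring of G_n appearing as a letter is stored as its
-- table of values: the row (φ(a_0),…,φ(a_{n-1})) and the row (φ(b_0),…,φ(b_{n-1})).
Table : ℕ → ℕ → Set
Table c n = Vec (Fin c) n × Vec (Fin c) n

⟦_⟧ : {c n : ℕ} → Table c n → Φ c n
⟦ ra , rb ⟧ (a t) = lookup ra t
⟦ ra , rb ⟧ (b t) = lookup rb t

-- The alphabet Σ = {(k, φ) : k ∈ {1..L}, φ ∈ Φ_{c,4k}}.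
-- k ∈ {1..L} is represented by κ : Fin L with k = kval κ = toℕ κ + 1.

kval : {L : ℕ} → Fin L → ℕ
kval κ = suc (toℕ κ)

Char : ℕ → ℕ → Set
Char c L = Σ (Fin L) (λ κ → Table c (4 * kval κ))

_≟Char_ : {c L : ℕ} → DecidableEquality (Char c L)
_≟Char_ = ProdP.≡-dec FinP._≟_ (ProdP.≡-dec (VecP.≡-dec FinP._≟_) (VecP.≡-dec FinP._≟_))

allVec : {A : Set} → List A → (n : ℕ) → List (Vec A n)
allVec xs zero = [] ∷ []
allVec xs (suc n) = concatMap (λ x → map (x ∷_) (allVec xs n)) xs

allTable : (c n : ℕ) → List (Table c n)
allTable c n = cartesianProduct (allVec (allFin c) n) (allVec (allFin c) n)

-- the finite alphabet Σ, each letter listed exactly once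
allChar : (c L : ℕ) → List (Char c L)
allChar c L = concatMap (λ κ → map (κ ,_) (allTable c (4 * kval κ))) (allFin L)

hist : {c L : ℕ} → Char c L → List (Char c L) → ℕ
hist x u = length (filter (x ≟Char_) u)

τ-at : {c L : ℕ} → ℕ → Char c L → List (Char c L) → ℕ
τ-at r x u = ∣ hist x (take r u) - hist x (drop r u) ∣

τ : (c L : ℕ) → ℕ → List (Char c L) → ℕ
τ c L r u = sum (map (λ x → τ-at r x u) (allChar c L))

Periodic : {A : Set} → ℕ → List A → Set
Periodic ℓ s = ∀ i → i + ℓ ≤ length s → ∀ x → x ∈ s → x ∈ take ℓ (drop i s)

Anagramish : {A : Set} → ℕ → List A → Set
Anagramish m w = take m w ↭ drop m w

nₛ : {c L : ℕ} → List (Char c L) → ℕ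
nₛ s = 4 * (length s + sum (map (λ x → kval (proj₁ x)) s))

columns : {c n : ℕ} → Φ c n → List (Fin c × Fin c)
columns φ = tabulate (λ t → φ (a t) , φ (b t))

block : {c L : ℕ} → Φ c 4 → Char c L → List (Fin c × Fin c)
block φ* (κ , T) = columns φ* ++ columns ⟦ T ⟧

allColumns : {c L : ℕ} → Φ c 4 → List (Char c L) → List (Fin c × Fin c)
allColumns φ* s = concatMap (block φ*) s

length-columns : {c n : ℕ} (φ : Φ c n) → length (columns φ) ≡ n
length-columns φ = length-tabulate _

length-allColumns : {c L : ℕ} (φ* : Φ c 4) (s : List (Char c L)) →
                    length (allColumns φ* s) ≡ nₛ s
length-allColumns φ* [] = refl
length-allColumns {c} φ* ((κ , T) ∷ s) =
  trans (length-++ (block φ* (κ , T)) {concatMap (block φ*) s})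
   (trans (cong₂ _+_ (trans (length-++ (columns φ*) {columns ⟦ T ⟧})
                        (cong₂ _+_ (length-columns φ*) (length-columns ⟦ T ⟧)))
                     (length-allColumns φ* s))
     (lemma (kval κ) (length s) (sum (map (λ x → kval (proj₁ x)) s))))
  where
  lemma : (k q S : ℕ) → (4 + 4 * k) + 4 * (q + S) ≡ 4 * (suc q + (k + S))
  lemma k q S = solve 3
    (λ k q S → (con 4 :+ con 4 :* k) :+ con 4 :* (q :+ S)
             := con 4 :* ((con 1 :+ q) :+ (k :+ S))) refl k q S

φₛ : {c L : ℕ} → Φ c 4 → (s : List (Char c L)) → Φ c (nₛ s)
φₛ φ* s (a j) = proj₁ (L.lookup (allColumns φ* s) (cast (Relation.Binary.PropositionalEquality.sym (length-allColumns φ* s)) j))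
  where import Relation.Binary.PropositionalEquality
φₛ φ* s (b j) = proj₂ (L.lookup (allColumns φ* s) (cast (Relation.Binary.PropositionalEquality.sym (length-allColumns φ* s)) j))
  where import Relation.Binary.PropositionalEquality

HasAnagramishPath : {c L : ℕ} → Φ c 4 → List (Char c L) → Set
HasAnagramishPath φ* s =
  Σ ℕ (λ m → 1 ≤ m × Σ (List (Vertex (nₛ s))) (λ vs →
    length vs ≡ 2 * m × IsPath vs × Anagramish m (map (φₛ φ* s) vs)))

{-# OPTIONS --safe #-}
module Submission where

-- Split s into halves s₁ s₂ and write them as multisets s₁ = K + p₁, s₂ = K + p₂ with p₁, p₂
-- disjoint; then |p₁| = |p₂| ≤ τ(s). The path sweeps G_{n_s} once from left to right. Through
-- most blocks it zigzags, visiting both vertices of every column; through a "straight" block it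
-- switches rows on the first column and then stays in one row. Two straight copies of the same
-- letter, one in each row, read the colours of the whole block plus one extra first column, which
-- is the same boring column for every letter. Taking two straight copies of each letter of p₁
-- inside s₁, and likewise for p₂ inside s₂, both halves of the colour sequence become the colours
-- of all blocks of K plus |p₁| boring columns, so they are anagrams. The copies exist because
-- ℓ-periodicity lets a greedy scan find each next letter within ℓ steps, and 2ℓ|p₁| ≤ 2ℓτ(s) ≤ r
-- for ε = 1/(2ℓ).

open import Defs
open import Data.Bool using (Bool; true; false; not; if_then_else_)
open import Data.Bool.Properties using (not-involutive)
open import Data.Fin using (Fin; zero; suc; toℕ; fromℕ<)
open import Data.Fin.Properties using (toℕ-fromℕ<; toℕ-cast)
open import Data.Integer as ℤ using (+_; +≤+; +<+)
import Data.Integer.Properties as ℤ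
open import Data.List using (List; []; _∷_; _++_; [_]; map; length; filter; take; drop; concatMap)
import Data.List as List
import Data.List.Properties as List
open import Data.List.Membership.Propositional using (_∈_; _∉_; lose)
open import Data.List.Membership.Propositional.Properties
  using (∈-∃++; ∈-++⁺ʳ; ∈-concatMap⁺; ∈-map⁺; ∈-cartesianProduct⁺; ∈-allFin)
open import Data.List.Relation.Unary.All as All using (All; []; _∷_)
open import Data.List.Relation.Unary.AllPairs using ([]; _∷_)
open import Data.List.Relation.Unary.Any using (here; there)
open import Data.List.Relation.Unary.Unique.Propositional using (Unique)
open import Data.List.Relation.Binary.Permutation.Propositional
  using (_↭_; ↭-refl; ↭-sym; ↭-trans; prep; swap; module PermutationReasoning)
open import Data.List.Relation.Binary.Permutation.Propositional.Properties
  using (++⁺; ++⁺ˡ; ++⁺ʳ; ++-comm; ++-assoc; shift; shifts; drop-∷; ↭-length; ∈-resp-↭; filter-↭)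
open import Data.List.Relation.Binary.Sublist.Propositional using (_⊆_; []; _∷_; _∷ʳ_; minimum; lookup)
open import Data.List.Relation.Binary.Sublist.Propositional.Properties using (take-⊆; drop-⊆)
open import Data.Nat using (ℕ; zero; suc; _+_; _*_; _∸_; _⊓_; _≤_; z≤n; s≤s; ∣_-_∣; NonZero)
import Data.Nat.Properties as ℕ
open import Data.Nat.Divisibility using (_∣_; divides; ∣1⇒≡1; ∣m+n∣m⇒∣n; ∣-refl; ∣m⇒∣m*n)
open import Data.Nat.ListAction using (sum)
open import Data.Product using (Σ; _×_; _,_; proj₁; proj₂)
open import Data.Rational using (ℚ; 0ℚ; _/_; _<_; toℚᵘ) renaming (_≤_ to _≤ℚ_; _*_ to _*ℚ_)
import Data.Rational.Properties as ℚ
import Data.Rational.Unnormalised as ℚᵘ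
import Data.Rational.Unnormalised.Properties as ℚᵘ
open import Data.Sum using (inj₁)
open import Data.Unit using (tt)
open import Data.Vec using (Vec; []; _∷_)
open import Function using (_∘_)
open import Relation.Binary.Definitions using (DecidableEquality)
open import Relation.Binary.PropositionalEquality
  using (_≡_; _≢_; refl; sym; trans; cong; cong₂; subst; subst₂; module ≡-Reasoning)
open import Relation.Nullary using (yes; no; contradiction)

private variable
  A B : Set

concatMap⁺ : (f : A → List B) {xs ys : List A} → xs ↭ ys → concatMap f xs ↭ concatMap f ys
concatMap⁺ f _↭_.refl = ↭-refl
concatMap⁺ f (prep x p) = ++⁺ˡ (f x) (concatMap⁺ f p)
concatMap⁺ f (swap x y p) = ↭-trans (shifts (f x) (f y)) (++⁺ˡ (f y) (++⁺ˡ (f x) (concatMap⁺ f p)))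
concatMap⁺ f (_↭_.trans p q) = ↭-trans (concatMap⁺ f p) (concatMap⁺ f q)

++-cancelˡ : (zs : List A) {xs ys : List A} → zs ++ xs ↭ zs ++ ys → xs ↭ ys
++-cancelˡ [] p = p
++-cancelˡ (z ∷ zs) p = ++-cancelˡ zs (drop-∷ p)

++-cancelʳ : (zs : List A) {xs ys : List A} → xs ++ zs ↭ ys ++ zs → xs ↭ ys
++-cancelʳ zs {xs} {ys} p = ++-cancelˡ zs (↭-trans (++-comm zs xs) (↭-trans p (++-comm ys zs)))

concatMap-const : (f : A → List B) {z : List B} → (∀ x → f x ≡ z) →
                  {xs ys : List A} → length xs ≡ length ys → concatMap f xs ≡ concatMap f ys
concatMap-const f f≡z {[]} {[]} _ = refl
concatMap-const f f≡z {x ∷ xs} {y ∷ ys} eq =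
  cong₂ _++_ (trans (f≡z x) (sym (f≡z y))) (concatMap-const f f≡z {xs} {ys} (ℕ.suc-injective eq))

take-length-++ : (xs ys : List A) → take (length xs) (xs ++ ys) ≡ xs
take-length-++ [] ys = refl
take-length-++ (x ∷ xs) ys = cong (x ∷_) (take-length-++ xs ys)

drop-length-++ : (xs ys : List A) → drop (length xs) (xs ++ ys) ≡ ys
drop-length-++ [] ys = refl
drop-length-++ (x ∷ xs) ys = drop-length-++ xs ys

drop-suc : ∀ j (xs : List A) {z zs} → drop j xs ≡ z ∷ zs → drop (suc j) xs ≡ zs
drop-suc zero (x ∷ xs) refl = refl
drop-suc (suc j) (x ∷ xs) eq = drop-suc j xs eq

lookup-drop : ∀ (xs : List A) (k : Fin (length xs)) {z zs} → drop (toℕ k) xs ≡ z ∷ zs → List.lookup xs k ≡ z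
lookup-drop (x ∷ xs) zero refl = refl
lookup-drop (x ∷ xs) (suc k) eq = lookup-drop xs k eq

length-halves : ∀ r (s : List A) → length s ≡ 2 * r → length (take r s) ≡ r × length (drop r s) ≡ r
length-halves r s ∣s∣≡2r =
  trans (List.length-take r s) (trans (cong (r ⊓_) ∣s∣≡r+r) (ℕ.m≤n⇒m⊓n≡m (ℕ.m≤m+n r r))) ,
  trans (List.length-drop r s) (trans (cong (_∸ r) ∣s∣≡r+r) (ℕ.m+n∸m≡n r r))
  where
  ∣s∣≡r+r : length s ≡ r + r
  ∣s∣≡r+r = trans ∣s∣≡2r (cong (λ n → r + n) (ℕ.+-identityʳ r))

sum-map-mono-≤ : ∀ (U : List A) {f g : A → ℕ} → (∀ z → f z ≤ g z) → sum (map f U) ≤ sum (map g U)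
sum-map-mono-≤ [] f≤g = z≤n
sum-map-mono-≤ (u ∷ U) f≤g = ℕ.+-mono-≤ (f≤g u) (sum-map-mono-≤ U f≤g)

double : List A → List A
double = concatMap (λ y → y ∷ y ∷ [])

length-double : (xs : List A) → length (double xs) ≡ length xs * 2
length-double [] = refl
length-double (x ∷ xs) = cong (λ n → suc (suc n)) (length-double xs)

double↭++ : (xs : List A) → double xs ↭ xs ++ xs
double↭++ [] = ↭-refl
double↭++ (x ∷ xs) = prep x (↭-trans (prep x (double↭++ xs)) (↭-sym (shift x xs xs)))

All-double : ∀ {P : A → Set} {xs : List A} → All P xs → All P (double xs)
All-double [] = []
All-double (px ∷ pxs) = px ∷ px ∷ All-double pxs

module Multiset {A : Set} (_≟_ : DecidableEquality A) where

  open import Data.List.Membership.DecPropositional _≟_ using (_∈?_)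

  count : A → List A → ℕ
  count x xs = length (filter (x ≟_) xs)

  count-++ : ∀ z xs ys → count z (xs ++ ys) ≡ count z xs + count z ys
  count-++ z xs ys = trans (cong length (List.filter-++ (z ≟_) xs ys)) (List.length-++ (filter (z ≟_) xs))

  count-↭ : ∀ z {xs ys} → xs ↭ ys → count z xs ≡ count z ys
  count-↭ z p = ↭-length (filter-↭ (z ≟_) p)

  count-∉ : ∀ {z} xs → z ∉ xs → count z xs ≡ 0
  count-∉ [] z∉ = refl
  count-∉ {z} (x ∷ xs) z∉ with z ≟ x
  ... | yes z≡x = contradiction (here z≡x) z∉
  ... | no _ = count-∉ xs (z∉ ∘ there)

  count-∷-self : ∀ y xs → count y (y ∷ xs) ≡ suc (count y xs)
  count-∷-self y xs with y ≟ y
  ... | yes _ = refl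
  ... | no y≢y = contradiction refl y≢y

  count-∷-≤ : ∀ z y xs → count z xs ≤ count z (y ∷ xs)
  count-∷-≤ z y xs with z ≟ y
  ... | yes _ = ℕ.n≤1+n _
  ... | no _ = ℕ.≤-refl

  sum-count-∷ : ∀ y xs {U} → y ∈ U →
                suc (sum (map (λ z → count z xs) U)) ≤ sum (map (λ z → count z (y ∷ xs)) U)
  sum-count-∷ y xs {u ∷ U} (here refl) =
    ℕ.+-mono-≤ (ℕ.≤-reflexive (sym (count-∷-self y xs))) (sum-map-mono-≤ U (λ z → count-∷-≤ z y xs))
  sum-count-∷ y xs {u ∷ U} (there y∈U) =
    ℕ.≤-trans (ℕ.≤-reflexive (sym (ℕ.+-suc (count u xs) _)))
      (ℕ.+-mono-≤ (count-∷-≤ u y xs) (sum-count-∷ y xs y∈U))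

  length≤sum-count : ∀ {U} → (∀ y → y ∈ U) → ∀ xs → length xs ≤ sum (map (λ z → count z xs) U)
  length≤sum-count complete [] = z≤n
  length≤sum-count complete (y ∷ xs) =
    ℕ.≤-trans (s≤s (length≤sum-count complete xs)) (sum-count-∷ y xs (complete y))

  record Intersection (xs ys : List A) : Set where
    field
      common onlyˡ onlyʳ : List A
      xs↭ : xs ↭ common ++ onlyˡ
      ys↭ : ys ↭ common ++ onlyʳ
      disjoint : ∀ {z} → z ∈ onlyˡ → z ∉ onlyʳ

  intersection : ∀ xs ys → Intersection xs ys
  intersection [] ys =
    record { common = [] ; onlyˡ = [] ; onlyʳ = ys ; xs↭ = ↭-refl ; ys↭ = ↭-refl ; disjoint = λ () }
  intersection (x ∷ xs) ys with x ∈? ys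
  ... | yes x∈ys with h , t , refl ← ∈-∃++ x∈ys =
    record { common = x ∷ common ; onlyˡ = onlyˡ ; onlyʳ = onlyʳ
           ; xs↭ = prep x xs↭
           ; ys↭ = ↭-trans (shift x h t) (prep x ys↭)
           ; disjoint = disjoint }
    where open Intersection (intersection xs (h ++ t))
  ... | no x∉ys =
    record { common = common ; onlyˡ = x ∷ onlyˡ ; onlyʳ = onlyʳ
           ; xs↭ = ↭-trans (prep x xs↭) (↭-sym (shift x common onlyˡ))
           ; ys↭ = ys↭
           ; disjoint = λ { (here refl) z∈ʳ → x∉ys (∈-resp-↭ (↭-sym ys↭) (∈-++⁺ʳ common z∈ʳ))
                          ; (there z∈ˡ) → disjoint z∈ˡ } }
    where open Intersection (intersection xs ys)

  module _ {xs ys : List A} (I : Intersection xs ys) where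
    open Intersection I

    ∈-onlyˡ : ∀ {z} → z ∈ onlyˡ → z ∈ xs
    ∈-onlyˡ z∈ = ∈-resp-↭ (↭-sym xs↭) (∈-++⁺ʳ common z∈)

    ∈-onlyʳ : ∀ {z} → z ∈ onlyʳ → z ∈ ys
    ∈-onlyʳ z∈ = ∈-resp-↭ (↭-sym ys↭) (∈-++⁺ʳ common z∈)

    length-onlyˡ≡length-onlyʳ : length xs ≡ length ys → length onlyˡ ≡ length onlyʳ
    length-onlyˡ≡length-onlyʳ ∣xs∣≡∣ys∣ = ℕ.+-cancelˡ-≡ (length common) _ _ (begin
      length common + length onlyˡ  ≡⟨ List.length-++ common ⟨
      length (common ++ onlyˡ)      ≡⟨ ↭-length xs↭ ⟨
      length xs                     ≡⟨ ∣xs∣≡∣ys∣ ⟩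
      length ys                     ≡⟨ ↭-length ys↭ ⟩
      length (common ++ onlyʳ)      ≡⟨ List.length-++ common ⟩
      length common + length onlyʳ  ∎)
      where open ≡-Reasoning

  count-onlyˡ≤ : ∀ {xs ys} (I : Intersection xs ys) z →
                 count z (Intersection.onlyˡ I) ≤ ∣ count z xs - count z ys ∣
  count-onlyˡ≤ {xs} {ys} I z with z ∈? Intersection.onlyˡ I
  ... | no z∉ˡ = subst (_≤ ∣ count z xs - count z ys ∣) (sym (count-∉ (Intersection.onlyˡ I) z∉ˡ)) z≤n
  ... | yes z∈ˡ = ℕ.≤-reflexive (sym (begin
    ∣ count z xs - count z ys ∣                                  ≡⟨ cong₂ ∣_-_∣ xs-count ys-count ⟩
    ∣ count z common + count z onlyˡ - count z common + 0 ∣     ≡⟨ cong (∣ count z common + count z onlyˡ -_∣) (ℕ.+-identityʳ _) ⟩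
    ∣ count z common + count z onlyˡ - count z common ∣         ≡⟨ ℕ.∣-∣-comm (count z common + count z onlyˡ) _ ⟩
    ∣ count z common - count z common + count z onlyˡ ∣         ≡⟨ ℕ.∣m-m+n∣≡n (count z common) _ ⟩
    count z onlyˡ                                                ∎))
    where
    open Intersection I
    open ≡-Reasoning
    xs-count : count z xs ≡ count z common + count z onlyˡ
    xs-count = trans (count-↭ z xs↭) (count-++ z common onlyˡ)
    ys-count : count z ys ≡ count z common + 0
    ys-count = trans (count-↭ z ys↭)
      (trans (count-++ z common onlyʳ) (cong (λ n → count z common + n) (count-∉ onlyʳ (disjoint z∈ˡ))))

-- Periodic ℓ s is Windowed ℓ s s.
Windowed : ℕ → List A → List A → Set
Windowed ℓ S w = ∀ i → i + ℓ ≤ length w → ∀ x → x ∈ S → x ∈ take ℓ (drop i w)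

Windowed-drop : ∀ {ℓ} {S w : List A} d → d ≤ length w → Windowed ℓ S w → Windowed ℓ S (drop d w)
Windowed-drop {ℓ = ℓ} {w = w} d d≤∣w∣ win i i+ℓ≤ x x∈S =
  subst (λ v → x ∈ take ℓ v) (sym (List.drop-drop d i w)) (win (d + i) bound x x∈S)
  where
  bound : d + i + ℓ ≤ length w
  bound = begin
    d + i + ℓ              ≡⟨ ℕ.+-assoc d i ℓ ⟩
    d + (i + ℓ)            ≤⟨ ℕ.+-monoʳ-≤ d (subst (i + ℓ ≤_) (List.length-drop d w) i+ℓ≤) ⟩
    d + (length w ∸ d)     ≡⟨ ℕ.m+[n∸m]≡n d≤∣w∣ ⟩
    length w               ∎
    where open ℕ.≤-Reasoning

Windowed-take : ∀ {ℓ} {S w : List A} r → Windowed ℓ S w → Windowed ℓ S (take r w)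
Windowed-take {ℓ = ℓ} {w = w} r win i i+ℓ≤ x x∈S = subst (x ∈_) (sym window-eq) (win i i+ℓ≤∣w∣ x x∈S)
  where
  i+ℓ≤r⊓∣w∣ : i + ℓ ≤ r ⊓ length w
  i+ℓ≤r⊓∣w∣ = subst (i + ℓ ≤_) (List.length-take r w) i+ℓ≤
  i+ℓ≤r : i + ℓ ≤ r
  i+ℓ≤r = ℕ.≤-trans i+ℓ≤r⊓∣w∣ (ℕ.m⊓n≤m r (length w))
  i+ℓ≤∣w∣ : i + ℓ ≤ length w
  i+ℓ≤∣w∣ = ℕ.≤-trans i+ℓ≤r⊓∣w∣ (ℕ.m⊓n≤n r (length w))
  window-eq : take ℓ (drop i (take r w)) ≡ take ℓ (drop i w)
  window-eq = begin
    take ℓ (drop i (take r w))       ≡⟨ List.take-drop ℓ i (take r w) ⟩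
    drop i (take (i + ℓ) (take r w)) ≡⟨ cong (drop i) (List.take-take (i + ℓ) r w) ⟩
    drop i (take ((i + ℓ) ⊓ r) w)    ≡⟨ cong (λ n → drop i (take n w)) (ℕ.m≤n⇒m⊓n≡m i+ℓ≤r) ⟩
    drop i (take (i + ℓ) w)          ≡⟨ List.take-drop ℓ i w ⟨
    take ℓ (drop i w)                ∎
    where open ≡-Reasoning

∷-⊆ : ∀ {ℓ} {y : A} {w} → y ∈ take ℓ w → Σ ℕ λ d → d ≤ ℓ × (∀ {T} → T ⊆ drop d w → y ∷ T ⊆ w)
∷-⊆ {ℓ = suc ℓ} {w = x ∷ w} (here refl) = 1 , s≤s z≤n , (refl ∷_)
∷-⊆ {ℓ = suc ℓ} {w = x ∷ w} (there y∈) with d , d≤ℓ , extend ← ∷-⊆ {ℓ = ℓ} y∈ =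
  suc d , s≤s d≤ℓ , (x ∷ʳ_) ∘ extend

⊆-of-windowed : ∀ {ℓ} {S w T : List A} → Windowed ℓ S w → All (_∈ S) T → length T * ℓ ≤ length w → T ⊆ w
⊆-of-windowed {T = []} win [] _ = minimum _
⊆-of-windowed {ℓ = ℓ} {w = w} {T = y ∷ T} win (y∈S ∷ T∈S) bound
  with d , d≤ℓ , extend ← ∷-⊆ (win 0 (ℕ.m+n≤o⇒m≤o ℓ bound) y y∈S) =
  extend (⊆-of-windowed (Windowed-drop d (ℕ.≤-trans d≤ℓ (ℕ.m+n≤o⇒m≤o ℓ bound)) win) T∈S rest-bound)
  where
  rest-bound : length T * ℓ ≤ length (drop d w)
  rest-bound = begin
    length T * ℓ        ≤⟨ ℕ.m+n≤o⇒m≤o∸n (length T * ℓ) (subst (_≤ length w) (ℕ.+-comm ℓ _) bound) ⟩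
    length w ∸ ℓ        ≤⟨ ℕ.∸-monoʳ-≤ (length w) d≤ℓ ⟩
    length w ∸ d        ≡⟨ List.length-drop d w ⟨
    length (drop d w)   ∎
    where open ℕ.≤-Reasoning

double-⊆-of-windowed : ∀ {ℓ} {S w p : List A} → Windowed ℓ S w → All (_∈ S) p →
                       length p * (2 * ℓ) ≤ length w → double p ⊆ w
double-⊆-of-windowed {ℓ = ℓ} {w = w} {p = p} win p∈S bound =
  ⊆-of-windowed win (All-double p∈S) (subst (_≤ length w) ∣p∣*[2*ℓ]≡∣double-p∣*ℓ bound)
  where
  ∣p∣*[2*ℓ]≡∣double-p∣*ℓ : length p * (2 * ℓ) ≡ length (double p) * ℓ
  ∣p∣*[2*ℓ]≡∣double-p∣*ℓ = trans (sym (ℕ.*-assoc (length p) 2 ℓ)) (cong (_* ℓ) (sym (length-double p)))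

module Sweep {X : Set} where

  Column : Set
  Column = X × X

  cells : List Column → List X
  cells = concatMap (λ (x , y) → x ∷ y ∷ [])

  cell : Bool → Column → X
  cell row (x , y) = if row then x else y

  -- A sweep tags each column with whether the path switches rows there: a tagged column is read in
  -- both cells, the current row first, an untagged one only in the current row (true is the a-row).
  reading : Bool → List (Column × Bool) → List X
  reading row [] = []
  reading row ((c , true) ∷ ms) = cell row c ∷ cell (not row) c ∷ reading (not row) ms
  reading row ((c , false) ∷ ms) = cell row c ∷ reading row ms

  exitRow : Bool → List (Column × Bool) → Bool
  exitRow row [] = row
  exitRow row ((_ , true) ∷ ms) = exitRow (not row) ms
  exitRow row ((_ , false) ∷ ms) = exitRow row ms

  reading-++ : ∀ row ms ns → reading row (ms ++ ns) ≡ reading row ms ++ reading (exitRow row ms) ns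
  reading-++ row [] ns = refl
  reading-++ row ((c , true) ∷ ms) ns = cong (λ r → _ ∷ _ ∷ r) (reading-++ (not row) ms ns)
  reading-++ row ((c , false) ∷ ms) ns = cong (_ ∷_) (reading-++ row ms ns)

  exitRow-++ : ∀ row ms ns → exitRow row (ms ++ ns) ≡ exitRow (exitRow row ms) ns
  exitRow-++ row [] ns = refl
  exitRow-++ row ((_ , true) ∷ ms) ns = exitRow-++ (not row) ms ns
  exitRow-++ row ((_ , false) ∷ ms) ns = exitRow-++ row ms ns

  exitRow-++-return : ∀ {row} ms ns → exitRow row ms ≡ row → exitRow row (ms ++ ns) ≡ exitRow row ns
  exitRow-++-return {row} ms ns returns = trans (exitRow-++ row ms ns) (cong (λ r → exitRow r ns) returns)

  reading-++-return : ∀ {row} ms ns → exitRow row ms ≡ row → reading row (ms ++ ns) ≡ reading row ms ++ reading row ns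
  reading-++-return {row} ms ns returns = trans (reading-++ row ms ns) (cong (λ r → reading row ms ++ reading r ns) returns)

  cell-pair : ∀ row c → cell row c ∷ cell (not row) c ∷ [] ↭ cells [ c ]
  cell-pair true c = ↭-refl
  cell-pair false c = swap _ _ ↭-refl

  zigzag : List Column → List (Column × Bool)
  zigzag = map (_, true)

  straight : List Column → List (Column × Bool)
  straight [] = []
  straight (c ∷ cs) = (c , true) ∷ map (_, false) cs

  columns-tagged : ∀ (t : Bool) (cs : List Column) → map proj₁ (map (_, t) cs) ≡ cs
  columns-tagged t cs = trans (sym (List.map-∘ cs)) (List.map-id cs)

  columns-straight : ∀ cs → map proj₁ (straight cs) ≡ cs
  columns-straight [] = refl
  columns-straight (c ∷ cs) = cong (c ∷_) (columns-tagged false cs)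

  reading-zigzag : ∀ row cs → reading row (zigzag cs) ↭ cells cs
  reading-zigzag row [] = ↭-refl
  reading-zigzag row (c ∷ cs) = ++⁺ (cell-pair row c) (reading-zigzag (not row) cs)

  exitRow-zigzag : ∀ row cs → 2 ∣ length cs → exitRow row (zigzag cs) ≡ row
  exitRow-zigzag row [] _ = refl
  exitRow-zigzag row (c ∷ []) 2∣1 with () ← ∣1⇒≡1 2∣1
  exitRow-zigzag row (c ∷ d ∷ cs) 2∣2+n =
    trans (exitRow-zigzag (not (not row)) cs (∣m+n∣m⇒∣n 2∣2+n ∣-refl)) (not-involutive row)

  reading-stay : ∀ row cs → reading row (map (_, false) cs) ≡ map (cell row) cs
  reading-stay row [] = refl
  reading-stay row (c ∷ cs) = cong (_ ∷_) (reading-stay row cs)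

  exitRow-stay : ∀ row cs → exitRow row (map (_, false) cs) ≡ row
  exitRow-stay row [] = refl
  exitRow-stay row (c ∷ cs) = exitRow-stay row cs

  rows↭cells : ∀ row cs → map (cell row) cs ++ map (cell (not row)) cs ↭ cells cs
  rows↭cells row [] = ↭-refl
  rows↭cells row (c ∷ cs) =
    ↭-trans (prep _ (shift _ (map (cell row) cs) _)) (++⁺ (cell-pair row c) (rows↭cells row cs))

  reading-straight : ∀ row c cs →
    reading row (straight (c ∷ cs)) ≡ cell row c ∷ cell (not row) c ∷ map (cell (not row)) cs
  reading-straight row c cs = cong (λ r → _ ∷ _ ∷ r) (reading-stay (not row) cs)

  exitRow-straight : ∀ row c cs → exitRow row (straight (c ∷ cs)) ≡ not row
  exitRow-straight row c cs = exitRow-stay (not row) cs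

  exitRow-straight-twice : ∀ row cs → exitRow row (straight cs ++ straight cs) ≡ row
  exitRow-straight-twice row [] = refl
  exitRow-straight-twice row (c ∷ cs) = begin
    exitRow row (S ++ S)           ≡⟨ exitRow-++ row S S ⟩
    exitRow (exitRow row S) S      ≡⟨ cong (λ r → exitRow r S) (exitRow-straight row c cs) ⟩
    exitRow (not row) S            ≡⟨ exitRow-straight (not row) c cs ⟩
    not (not row)                  ≡⟨ not-involutive row ⟩
    row                            ∎
    where
    open ≡-Reasoning
    S = straight (c ∷ cs)

  reading-straight-twice : ∀ row cs → reading row (straight cs ++ straight cs) ↭ cells cs ++ cells (take 1 cs)
  reading-straight-twice row [] = ↭-refl
  reading-straight-twice row (c ∷ cs) = begin
    reading row (S ++ S)
      ≡⟨ reading-++ row S S ⟩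
    reading row S ++ reading (exitRow row S) S
      ≡⟨ cong₂ _++_ (reading-straight row c cs)
           (trans (cong (λ r → reading r S) (exitRow-straight row c cs))
             (trans (reading-straight (not row) c cs)
               (cong (λ r → v ∷ cell r c ∷ map (cell r) cs) (not-involutive row)))) ⟩
    (u ∷ v ∷ []) ++ R′ ++ (v ∷ u ∷ []) ++ R
      ↭⟨ ++⁺ˡ (u ∷ v ∷ []) (shifts R′ (v ∷ u ∷ [])) ⟩
    (u ∷ v ∷ []) ++ (v ∷ u ∷ []) ++ R′ ++ R
      ↭⟨ ++⁺ (cell-pair row c) (++⁺ (↭-trans (swap v u ↭-refl) (cell-pair row c)) (++-comm R′ R)) ⟩
    cells [ c ] ++ cells [ c ] ++ R ++ R′
      ↭⟨ ++⁺ˡ (cells [ c ]) (↭-trans (++⁺ˡ (cells [ c ]) (rows↭cells row cs)) (++-comm (cells [ c ]) (cells cs))) ⟩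
    cells [ c ] ++ cells cs ++ cells [ c ] ∎
    where
    open PermutationReasoning
    S = straight (c ∷ cs)
    u v : X
    u = cell row c
    v = cell (not row) c
    R R′ : List X
    R = map (cell row) cs
    R′ = map (cell (not row)) cs

  module Blocks {A : Set} (columnsOf : A → List Column) (even : ∀ y → 2 ∣ length (columnsOf y)) where

    sweep : {T w : List A} → T ⊆ w → List (Column × Bool)
    sweep [] = []
    sweep (y ∷ʳ τ) = zigzag (columnsOf y) ++ sweep τ
    sweep (_∷_ {y = y} _ τ) = straight (columnsOf y) ++ sweep τ

    skipped : {T w : List A} → T ⊆ w → List A
    skipped [] = []
    skipped (y ∷ʳ τ) = y ∷ skipped τ
    skipped (_ ∷ τ) = skipped τ

    straights : List A → List (Column × Bool)
    straights = concatMap (straight ∘ columnsOf)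

    blockCells : List A → List X
    blockCells = concatMap (cells ∘ columnsOf)

    firstCells : List A → List X
    firstCells = concatMap (cells ∘ take 1 ∘ columnsOf)

    columns-sweep : {T w : List A} (τ : T ⊆ w) → map proj₁ (sweep τ) ≡ concatMap columnsOf w
    columns-sweep [] = refl
    columns-sweep (y ∷ʳ τ) =
      trans (List.map-++ proj₁ (zigzag (columnsOf y)) (sweep τ)) (cong₂ _++_ (columns-tagged true (columnsOf y)) (columns-sweep τ))
    columns-sweep (_∷_ {y = y} _ τ) =
      trans (List.map-++ proj₁ (straight (columnsOf y)) (sweep τ)) (cong₂ _++_ (columns-straight (columnsOf y)) (columns-sweep τ))

    columns-sweep-++ : ∀ {T₁ w₁ T₂ w₂ : List A} (τ₁ : T₁ ⊆ w₁) (τ₂ : T₂ ⊆ w₂) →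
                       map proj₁ (sweep τ₁ ++ sweep τ₂) ≡ concatMap columnsOf (w₁ ++ w₂)
    columns-sweep-++ {w₁ = w₁} {w₂ = w₂} τ₁ τ₂ = begin
      map proj₁ (sweep τ₁ ++ sweep τ₂)                 ≡⟨ List.map-++ proj₁ (sweep τ₁) (sweep τ₂) ⟩
      map proj₁ (sweep τ₁) ++ map proj₁ (sweep τ₂)     ≡⟨ cong₂ _++_ (columns-sweep τ₁) (columns-sweep τ₂) ⟩
      concatMap columnsOf w₁ ++ concatMap columnsOf w₂ ≡⟨ List.concatMap-++ columnsOf w₁ w₂ ⟨
      concatMap columnsOf (w₁ ++ w₂)                   ∎
      where open ≡-Reasoning

    ↭-skipped : {T w : List A} (τ : T ⊆ w) → w ↭ skipped τ ++ T
    ↭-skipped [] = ↭-refl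
    ↭-skipped (y ∷ʳ τ) = prep y (↭-skipped τ)
    ↭-skipped (_∷_ {y = y} refl τ) = ↭-trans (prep y (↭-skipped τ)) (↭-sym (shift y (skipped τ) _))

    exitRow-sweep : ∀ row {T w : List A} (τ : T ⊆ w) → exitRow row (sweep τ) ≡ exitRow row (straights T)
    exitRow-sweep row [] = refl
    exitRow-sweep row (y ∷ʳ τ) =
      trans (exitRow-++-return (zigzag (columnsOf y)) (sweep τ) (exitRow-zigzag row (columnsOf y) (even y)))
            (exitRow-sweep row τ)
    exitRow-sweep row {_ ∷ T} (_∷_ {y = y} refl τ) = begin
      exitRow row (straight (columnsOf y) ++ sweep τ)  ≡⟨ exitRow-++ row (straight (columnsOf y)) (sweep τ) ⟩
      exitRow row′ (sweep τ)                           ≡⟨ exitRow-sweep row′ τ ⟩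
      exitRow row′ (straights T)                       ≡⟨ exitRow-++ row (straight (columnsOf y)) (straights T) ⟨
      exitRow row (straights (y ∷ T))                  ∎
      where
      open ≡-Reasoning
      row′ = exitRow row (straight (columnsOf y))

    reading-sweep : ∀ row {T w : List A} (τ : T ⊆ w) →
                    reading row (sweep τ) ↭ blockCells (skipped τ) ++ reading row (straights T)
    reading-sweep row [] = ↭-refl
    reading-sweep row {T} (y ∷ʳ τ) = begin
      reading row (zigzag (columnsOf y) ++ sweep τ)
        ≡⟨ reading-++-return (zigzag (columnsOf y)) (sweep τ) (exitRow-zigzag row (columnsOf y) (even y)) ⟩
      reading row (zigzag (columnsOf y)) ++ reading row (sweep τ)
        ↭⟨ ++⁺ (reading-zigzag row (columnsOf y)) (reading-sweep row τ) ⟩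
      cells (columnsOf y) ++ blockCells (skipped τ) ++ reading row (straights T)
        ≡⟨ List.++-assoc (cells (columnsOf y)) (blockCells (skipped τ)) (reading row (straights T)) ⟨
      blockCells (y ∷ skipped τ) ++ reading row (straights T) ∎
      where open PermutationReasoning
    reading-sweep row {_ ∷ T} (_∷_ {y = y} refl τ) = begin
      reading row (S ++ sweep τ)                   ≡⟨ reading-++ row S (sweep τ) ⟩
      reading row S ++ reading row′ (sweep τ)      ↭⟨ ++⁺ˡ (reading row S) (reading-sweep row′ τ) ⟩
      reading row S ++ skippedCells ++ reading row′ (straights T)
                                                   ↭⟨ shifts (reading row S) skippedCells ⟩
      skippedCells ++ reading row S ++ reading row′ (straights T)
                                                   ≡⟨ cong (skippedCells ++_) (reading-++ row S (straights T)) ⟨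
      skippedCells ++ reading row (straights (y ∷ T))         ∎
      where
      open PermutationReasoning
      S = straight (columnsOf y)
      row′ = exitRow row S
      skippedCells = blockCells (skipped τ)

    exitRow-straights-double : ∀ row (p : List A) → exitRow row (straights (double p)) ≡ row
    exitRow-straights-double row [] = refl
    exitRow-straights-double row (y ∷ p) = begin
      exitRow row (S ++ S ++ straights (double p))    ≡⟨ cong (exitRow row) (List.++-assoc S S _) ⟨
      exitRow row ((S ++ S) ++ straights (double p))  ≡⟨ exitRow-++-return (S ++ S) _ (exitRow-straight-twice row (columnsOf y)) ⟩
      exitRow row (straights (double p))              ≡⟨ exitRow-straights-double row p ⟩
      row                                             ∎
      where
      open ≡-Reasoning
      S = straight (columnsOf y)

    reading-straights-double : ∀ row (p : List A) → reading row (straights (double p)) ↭ blockCells p ++ firstCells p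
    reading-straights-double row [] = ↭-refl
    reading-straights-double row (y ∷ p) = begin
      reading row (S ++ S ++ straights (double p))
        ≡⟨ cong (reading row) (List.++-assoc S S _) ⟨
      reading row ((S ++ S) ++ straights (double p))
        ≡⟨ reading-++-return (S ++ S) _ (exitRow-straight-twice row (columnsOf y)) ⟩
      reading row (S ++ S) ++ reading row (straights (double p))
        ↭⟨ ++⁺ (reading-straight-twice row (columnsOf y)) (reading-straights-double row p) ⟩
      (all ++ first) ++ blockCells p ++ firstCells p
        ↭⟨ ++-assoc all first _ ⟩
      all ++ first ++ blockCells p ++ firstCells p
        ↭⟨ ++⁺ˡ all (shifts first (blockCells p)) ⟩
      all ++ blockCells p ++ first ++ firstCells p
        ↭⟨ ++-assoc all (blockCells p) _ ⟨
      blockCells (y ∷ p) ++ firstCells (y ∷ p)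
        ∎
      where
      open PermutationReasoning
      S = straight (columnsOf y)
      all = cells (columnsOf y)
      first = cells (take 1 (columnsOf y))

    reading-sweep-double : ∀ row {p K w : List A} (τ : double p ⊆ w) → w ↭ K ++ p →
                           reading row (sweep τ) ↭ blockCells K ++ firstCells p
    reading-sweep-double row {p} {K} {w} τ w↭K++p = begin
      reading row (sweep τ)                                ↭⟨ reading-sweep row τ ⟩
      blockCells (skipped τ) ++ reading row (straights (double p))
                                                           ↭⟨ ++⁺ˡ (blockCells (skipped τ)) (reading-straights-double row p) ⟩
      blockCells (skipped τ) ++ blockCells p ++ firstCells p  ≡⟨ blockCells-++ ⟨
      blockCells (skipped τ ++ p) ++ firstCells p          ↭⟨ ++⁺ʳ (firstCells p) (concatMap⁺ (cells ∘ columnsOf) skipped++p↭K) ⟩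
      blockCells K ++ firstCells p                         ∎
      where
      open PermutationReasoning
      blockCells-++ : blockCells (skipped τ ++ p) ++ firstCells p ≡ blockCells (skipped τ) ++ blockCells p ++ firstCells p
      blockCells-++ = trans (cong (_++ firstCells p) (List.concatMap-++ (cells ∘ columnsOf) (skipped τ) p))
                            (List.++-assoc (blockCells (skipped τ)) (blockCells p) (firstCells p))
      skipped++p↭K : skipped τ ++ p ↭ K
      skipped++p↭K = ++-cancelʳ p (begin
        (skipped τ ++ p) ++ p    ↭⟨ ++-assoc (skipped τ) p p ⟩
        skipped τ ++ p ++ p      ↭⟨ ++⁺ˡ (skipped τ) (double↭++ p) ⟨
        skipped τ ++ double p    ↭⟨ ↭-skipped τ ⟨
        w                        ↭⟨ w↭K++p ⟩
        K ++ p                   ∎)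

module Route {n : ℕ} where

  position : Vertex n → Bool × ℕ
  position (a i) = true , toℕ i
  position (b i) = false , toℕ i

  column : Vertex n → ℕ
  column = proj₂ ∘ position

  at : Bool → (j : ℕ) → suc j ≤ n → Vertex n
  at true j j<n = a (fromℕ< j<n)
  at false j j<n = b (fromℕ< j<n)

  position-at : ∀ r j (j<n : suc j ≤ n) → position (at r j j<n) ≡ (r , j)
  position-at true j j<n = cong (true ,_) (toℕ-fromℕ< j<n)
  position-at false j j<n = cong (false ,_) (toℕ-fromℕ< j<n)

  Adj-horizontal : ∀ {v w r k} → position v ≡ (r , k) → position w ≡ (r , suc k) → Adj v w
  Adj-horizontal {a i} {a j} refl eq = inj₁ (cong proj₂ eq) , tt
  Adj-horizontal {b i} {b j} refl eq = inj₁ (cong proj₂ eq) , tt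
  Adj-horizontal {a i} {b j} refl ()
  Adj-horizontal {b i} {a j} refl ()

  Adj-vertical : ∀ r j (j<n : suc j ≤ n) → Adj (at r j j<n) (at (not r) j j<n)
  Adj-vertical true j j<n = refl
  Adj-vertical false j j<n = refl

  at-vertical-≢ : ∀ r j (j<n : suc j ≤ n) → at r j j<n ≢ at (not r) j j<n
  at-vertical-≢ true j j<n ()
  at-vertical-≢ false j j<n ()

  private
    head< : ∀ {j m} → j + suc m ≡ n → suc j ≤ n
    head< {j} {m} eq = subst (suc j ≤_) eq (ℕ.m<m+n j (s≤s z≤n))

    tail≡ : ∀ {j m} → j + suc m ≡ n → suc j + m ≡ n
    tail≡ {j} {m} eq = trans (sym (ℕ.+-suc j m)) eq

  route : {C : Set} → Bool → (j : ℕ) (ms : List (C × Bool)) → j + length ms ≡ n → List (Vertex n)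
  route r j [] _ = []
  route r j ((_ , true) ∷ ms) eq = at r j (head< eq) ∷ at (not r) j (head< eq) ∷ route (not r) (suc j) ms (tail≡ eq)
  route r j ((_ , false) ∷ ms) eq = at r j (head< eq) ∷ route r (suc j) ms (tail≡ eq)

  module _ {C : Set} where

    Walk-∷-route : ∀ {v} r j (ms : List (C × Bool)) eq → position v ≡ (r , j) → Walk (v ∷ route r (suc j) ms eq)
    Walk-route : ∀ r j (ms : List (C × Bool)) eq → Walk (route r j ms eq)
    Walk-∷-route r j [] eq pos = tt
    Walk-∷-route r j (m@(_ , true) ∷ ms) eq pos =
      Adj-horizontal pos (position-at r (suc j) _) , Walk-route r (suc j) (m ∷ ms) eq
    Walk-∷-route r j (m@(_ , false) ∷ ms) eq pos =
      Adj-horizontal pos (position-at r (suc j) _) , Walk-route r (suc j) (m ∷ ms) eq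
    Walk-route r j [] eq = tt
    Walk-route r j ((_ , true) ∷ ms) eq =
      Adj-vertical r j _ , Walk-∷-route (not r) j ms _ (position-at (not r) j _)
    Walk-route r j ((_ , false) ∷ ms) eq = Walk-∷-route r j ms _ (position-at r j _)

    column-at : ∀ r j (j<n : suc j ≤ n) → column (at r j j<n) ≡ j
    column-at r j j<n = cong proj₂ (position-at r j j<n)

    route-columns≥ : ∀ r j (ms : List (C × Bool)) eq → All (λ v → j ≤ column v) (route r j ms eq)
    route-columns≥ r j [] eq = []
    route-columns≥ r j ((_ , true) ∷ ms) eq =
      ℕ.≤-reflexive (sym (column-at r j _)) ∷ ℕ.≤-reflexive (sym (column-at (not r) j _)) ∷
      All.map ℕ.<⇒≤ (route-columns≥ (not r) (suc j) ms _)
    route-columns≥ r j ((_ , false) ∷ ms) eq =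
      ℕ.≤-reflexive (sym (column-at r j _)) ∷ All.map ℕ.<⇒≤ (route-columns≥ r (suc j) ms _)

    private
      left-of : ∀ {v j} → column v ≡ j → ∀ {ws} → All (λ w → suc j ≤ column w) ws → All (v ≢_) ws
      left-of v≡j = All.map (λ j<w v≡w → ℕ.<-irrefl (trans (sym v≡j) (cong column v≡w)) j<w)

    Unique-route : ∀ r j (ms : List (C × Bool)) eq → Unique (route r j ms eq)
    Unique-route r j [] eq = []
    Unique-route r j ((_ , true) ∷ ms) eq =
      (at-vertical-≢ r j _ ∷ left-of (column-at r j _) (route-columns≥ (not r) (suc j) ms _)) ∷
      left-of (column-at (not r) j _) (route-columns≥ (not r) (suc j) ms _) ∷
      Unique-route (not r) (suc j) ms _
    Unique-route r j ((_ , false) ∷ ms) eq =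
      left-of (column-at r j _) (route-columns≥ r (suc j) ms _) ∷ Unique-route r (suc j) ms _

    IsPath-route : ∀ r j (ms : List (C × Bool)) eq → IsPath (route r j ms eq)
    IsPath-route r j ms eq = Walk-route r j ms eq , Unique-route r j ms eq

  module _ {X : Set} where
    open Sweep {X}

    HasColumns : (Vertex n → X) → List (X × X) → Set
    HasColumns φ cols = ∀ i {z zs} → drop (toℕ i) cols ≡ z ∷ zs → (φ (a i) , φ (b i)) ≡ z

    module _ {φ : Vertex n → X} {cols : List (X × X)} (φ-cols : HasColumns φ cols) where

      colour-at : ∀ r j (j<n : suc j ≤ n) {z zs} → drop j cols ≡ z ∷ zs → φ (at r j j<n) ≡ cell r z
      colour-at true j j<n eq = cong proj₁ (φ-cols (fromℕ< j<n) (trans (cong (λ k → drop k cols) (toℕ-fromℕ< j<n)) eq))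
      colour-at false j j<n eq = cong proj₂ (φ-cols (fromℕ< j<n) (trans (cong (λ k → drop k cols) (toℕ-fromℕ< j<n)) eq))

      colours-route : ∀ r j ms eq → map proj₁ ms ≡ drop j cols → map φ (route r j ms eq) ≡ reading r ms
      colours-route r j [] eq _ = refl
      colours-route r j ((z , true) ∷ ms) eq ms≡ =
        cong₂ _∷_ (colour-at r j _ (sym ms≡))
          (cong₂ _∷_ (colour-at (not r) j _ (sym ms≡))
            (colours-route (not r) (suc j) ms _ (sym (drop-suc j cols (sym ms≡)))))
      colours-route r j ((z , false) ∷ ms) eq ms≡ =
        cong₂ _∷_ (colour-at r j _ (sym ms≡)) (colours-route r (suc j) ms _ (sym (drop-suc j cols (sym ms≡))))

toℚᵘ-/ : ∀ i k → toℚᵘ (i / suc k) ℚᵘ.≃ ℚᵘ.mkℚᵘ i k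
toℚᵘ-/ i k = ℚ.toℚᵘ-fromℚᵘ (ℚᵘ.mkℚᵘ i k)

0<1/n : ∀ n .{{_ : NonZero n}} → 0ℚ < + 1 / n
0<1/n (suc k) = ℚ.toℚᵘ-cancel-< (ℚᵘ.<-respʳ-≃ (ℚᵘ.≃-sym (toℚᵘ-/ (+ 1) k)) (ℚᵘ.*<* (+<+ (s≤s z≤n))))

t≤[1/n]*r⇒t*n≤r : ∀ n .{{_ : NonZero n}} t r → + t / 1 ≤ℚ (+ 1 / n) *ℚ (+ r / 1) → t * n ≤ r
t≤[1/n]*r⇒t*n≤r (suc k) t r t≤r/n = cross-multiplied unnormalised
  where
  product : toℚᵘ ((+ 1 / suc k) *ℚ (+ r / 1)) ℚᵘ.≃ ℚᵘ.mkℚᵘ (+ 1) k ℚᵘ.* ℚᵘ.mkℚᵘ (+ r) 0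
  product = ℚᵘ.≃-trans (ℚ.toℚᵘ-homo-* (+ 1 / suc k) (+ r / 1)) (ℚᵘ.*-cong (toℚᵘ-/ (+ 1) k) (toℚᵘ-/ (+ r) 0))
  unnormalised : ℚᵘ.mkℚᵘ (+ t) 0 ℚᵘ.≤ ℚᵘ.mkℚᵘ (+ 1) k ℚᵘ.* ℚᵘ.mkℚᵘ (+ r) 0
  unnormalised =
    ℚᵘ.≤-respˡ-≃ (toℚᵘ-/ (+ t) 0)
      (ℚᵘ.≤-respʳ-≃ product (ℚ.toℚᵘ-mono-≤ t≤r/n))
  cross-multiplied : ℚᵘ.mkℚᵘ (+ t) 0 ℚᵘ.≤ ℚᵘ.mkℚᵘ (+ 1) k ℚᵘ.* ℚᵘ.mkℚᵘ (+ r) 0 → t * suc k ≤ r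
  cross-multiplied (ℚᵘ.*≤* le)
    with subst₂ ℤ._≤_ (sym (ℤ.pos-* t (suc k * 1))) (trans (ℤ.*-identityʳ _) (ℤ.*-identityˡ (+ r))) le
  ... | +≤+ le′ = subst (λ n → t * n ≤ r) (ℕ.*-identityʳ (suc k)) le′

∈-allVec : ∀ {xs : List A} → (∀ x → x ∈ xs) → ∀ {n} (v : Vec A n) → v ∈ allVec xs n
∈-allVec complete [] = here refl
∈-allVec {xs = xs} complete {suc n} (x ∷ v) =
  ∈-concatMap⁺ (λ y → map (y ∷_) (allVec xs n)) (lose (complete x) (∈-map⁺ (x ∷_) (∈-allVec complete v)))

∈-allChar : ∀ {c L} (x : Char c L) → x ∈ allChar c L
∈-allChar {c} (κ , (ra , rb)) =
  ∈-concatMap⁺ (λ κ → map (κ ,_) (allTable c (4 * kval κ)))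
    (lose (∈-allFin κ) (∈-map⁺ (κ ,_) (∈-cartesianProduct⁺ (∈-allVec ∈-allFin ra) (∈-allVec ∈-allFin rb))))

module _ {c L : ℕ} (φ* : Φ c 4) where
  open Sweep {Fin c}
  open Multiset (_≟Char_ {c} {L})

  φₛ-columns : ∀ (s : List (Char c L)) → Route.HasColumns {nₛ s} (φₛ φ* s) (allColumns φ* s)
  φₛ-columns s i eq = lookup-drop (allColumns φ* s) _ (trans (cong (λ k → drop k (allColumns φ* s)) (toℕ-cast _ i)) eq)

  2∣length-block : ∀ (y : Char c L) → 2 ∣ length (block φ* y)
  2∣length-block (κ , T) = subst (2 ∣_) (sym length-block) (∣m⇒∣m*n (suc (kval κ)) (divides 2 refl))
    where
    length-block : length (block φ* (κ , T)) ≡ 4 * suc (kval κ)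
    length-block = begin
      length (columns φ* ++ columns ⟦ T ⟧)  ≡⟨ List.length-++ (columns φ*) {columns ⟦ T ⟧} ⟩
      4 + length (columns ⟦ T ⟧)            ≡⟨ cong (λ m → 4 + m) (length-columns ⟦ T ⟧) ⟩
      4 + 4 * kval κ                        ≡⟨ ℕ.*-suc 4 (kval κ) ⟨
      4 * suc (kval κ)                      ∎
      where open ≡-Reasoning

  open Blocks (block φ*) 2∣length-block

  anagramish-path : ∀ (s : List (Char c L)) (ms : List (Column × Bool)) → map proj₁ ms ≡ allColumns φ* s →
                    ∀ {H₁ H₂} → reading true ms ≡ H₁ ++ H₂ → H₁ ↭ H₂ → 1 ≤ length H₁ →
                    HasAnagramishPath φ* s
  anagramish-path s ms ms-columns {H₁} {H₂} reading≡ H₁↭H₂ 1≤∣H₁∣ =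
    length H₁ , 1≤∣H₁∣ , vs , length-vs , IsPath-route true 0 ms ∣ms∣≡n , anagram
    where
    open Route {nₛ s}
    ∣ms∣≡n : 0 + length ms ≡ nₛ s
    ∣ms∣≡n = trans (sym (List.length-map proj₁ ms)) (trans (cong length ms-columns) (length-allColumns φ* s))
    vs : List (Vertex (nₛ s))
    vs = route true 0 ms ∣ms∣≡n
    colours : map (φₛ φ* s) vs ≡ H₁ ++ H₂
    colours = trans (colours-route (φₛ-columns s) true 0 ms ∣ms∣≡n ms-columns) reading≡
    length-vs : length vs ≡ 2 * length H₁
    length-vs = begin
      length vs                  ≡⟨ List.length-map (φₛ φ* s) vs ⟨
      length (map (φₛ φ* s) vs)  ≡⟨ cong length colours ⟩
      length (H₁ ++ H₂)          ≡⟨ List.length-++ H₁ ⟩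
      length H₁ + length H₂      ≡⟨ cong (λ m → length H₁ + m) (sym (↭-length H₁↭H₂)) ⟩
      length H₁ + length H₁      ≡⟨ cong (λ m → length H₁ + m) (ℕ.+-identityʳ _) ⟨
      2 * length H₁              ∎
      where open ≡-Reasoning
    anagram : Anagramish (length H₁) (map (φₛ φ* s) vs)
    anagram rewrite colours | take-length-++ H₁ H₂ | drop-length-++ H₁ H₂ = H₁↭H₂

  -- hist is count for _≟Char_, so τ-at r z s is the right-hand side of count-onlyˡ≤.
  length-onlyˡ≤τ : ∀ r (s : List (Char c L)) →
                   length (Intersection.onlyˡ (intersection (take r s) (drop r s))) ≤ τ c L r s
  length-onlyˡ≤τ r s =
    ℕ.≤-trans (length≤sum-count ∈-allChar (Intersection.onlyˡ I)) (sum-map-mono-≤ (allChar c L) (count-onlyˡ≤ I))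
    where I = intersection (take r s) (drop r s)

  reading-sweep-nonempty : ∀ row {T w : List (Char c L)} (τ : T ⊆ w) → 1 ≤ length w →
                           1 ≤ length (reading row (sweep τ))
  reading-sweep-nonempty row {w = (κ , T) ∷ w} (_ ∷ʳ τ) _ = s≤s z≤n
  reading-sweep-nonempty row {w = (κ , T) ∷ w} (_ ∷ τ) _ = s≤s z≤n

  reading-sweeps-↭ : ∀ row (p₁ p₂ : List (Char c L)) {K w₁ w₂} (τ₁ : double p₁ ⊆ w₁) (τ₂ : double p₂ ⊆ w₂) →
                     w₁ ↭ K ++ p₁ → w₂ ↭ K ++ p₂ → length p₁ ≡ length p₂ →
                     reading row (sweep τ₁) ↭ reading row (sweep τ₂)
  reading-sweeps-↭ row p₁ p₂ {K} τ₁ τ₂ w₁↭ w₂↭ ∣p₁∣≡∣p₂∣ = begin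
    reading row (sweep τ₁)         ↭⟨ reading-sweep-double row {p₁} τ₁ w₁↭ ⟩
    blockCells K ++ firstCells p₁  ≡⟨ cong (blockCells K ++_) first-columns ⟩
    blockCells K ++ firstCells p₂  ↭⟨ reading-sweep-double row {p₂} τ₂ w₂↭ ⟨
    reading row (sweep τ₂)         ∎
    where
    open PermutationReasoning
    -- Every block starts with the boring column of φ*.
    first-columns : firstCells p₁ ≡ firstCells p₂
    first-columns = concatMap-const (cells ∘ take 1 ∘ block φ*) (λ _ → refl) {p₁} {p₂} ∣p₁∣≡∣p₂∣

  anagramish-path-of-balanced : ∀ ℓ r → 1 ≤ r → (s : List (Char c L)) → length s ≡ 2 * r → Periodic ℓ s →
                                τ c L r s * (2 * ℓ) ≤ r → HasAnagramishPath φ* s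
  anagramish-path-of-balanced ℓ r 1≤r s ∣s∣≡2r periodic τ-small =
    anagramish-path s (sweep τ₁ ++ sweep τ₂)
      (trans (columns-sweep-++ τ₁ τ₂) (cong (concatMap (block φ*)) (List.take++drop≡id r s)))
      (reading-++-return (sweep τ₁) (sweep τ₂) (trans (exitRow-sweep true τ₁) (exitRow-straights-double true onlyˡ)))
      (reading-sweeps-↭ true onlyˡ onlyʳ τ₁ τ₂ xs↭ ys↭ ∣onlyˡ∣≡∣onlyʳ∣)
      (reading-sweep-nonempty true τ₁ (subst (1 ≤_) (sym ∣s₁∣≡r) 1≤r))
    where
    s₁ s₂ : List (Char c L)
    s₁ = take r s
    s₂ = drop r s
    I = intersection s₁ s₂
    open Intersection I
    ∣s₁∣≡r : length s₁ ≡ r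
    ∣s₁∣≡r = proj₁ (length-halves r s ∣s∣≡2r)
    ∣s₂∣≡r : length s₂ ≡ r
    ∣s₂∣≡r = proj₂ (length-halves r s ∣s∣≡2r)
    ∣onlyˡ∣≡∣onlyʳ∣ : length onlyˡ ≡ length onlyʳ
    ∣onlyˡ∣≡∣onlyʳ∣ = length-onlyˡ≡length-onlyʳ I (trans ∣s₁∣≡r (sym ∣s₂∣≡r))
    fits : ∀ (p w : List (Char c L)) → length p ≡ length onlyˡ → length w ≡ r → length p * (2 * ℓ) ≤ length w
    fits p w ∣p∣≡ ∣w∣≡r = subst₂ _≤_ (cong (_* (2 * ℓ)) (sym ∣p∣≡)) (sym ∣w∣≡r)
      (ℕ.≤-trans (ℕ.*-monoˡ-≤ (2 * ℓ) (length-onlyˡ≤τ r s)) τ-small)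
    τ₁ : double onlyˡ ⊆ s₁
    τ₁ = double-⊆-of-windowed {p = onlyˡ} (Windowed-take r periodic)
           (All.tabulate (lookup (take-⊆ r s) ∘ ∈-onlyˡ I)) (fits onlyˡ s₁ refl ∣s₁∣≡r)
    τ₂ : double onlyʳ ⊆ s₂
    τ₂ = double-⊆-of-windowed {p = onlyʳ} (Windowed-drop r (subst (r ≤_) (sym ∣s∣≡2r) (ℕ.m≤m+n r _)) periodic)
           (All.tabulate (lookup (drop-⊆ r s) ∘ ∈-onlyʳ I)) (fits onlyʳ s₂ (sym ∣onlyˡ∣≡∣onlyʳ∣) ∣s₂∣≡r)

lemma7 : (c L : ℕ) → 1 ≤ c → 1 ≤ L → (φ* : Φ c 4) →
    (ℓ : ℕ) → 1 ≤ ℓ →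
    Σ ℚ (λ ε → 0ℚ < ε × Σ ℕ (λ r₀ →
      (r : ℕ) → r₀ ≤ r →
      (s : List (Char c L)) → length s ≡ 2 * r →
      Periodic ℓ s →
      ((+ τ c L r s) / 1) ≤ℚ (ε *ℚ ((+ r) / 1)) →
      HasAnagramishPath φ* s))
lemma7 c L _ _ φ* ℓ@(suc _) _ =
  + 1 / (2 * ℓ) , 0<1/n (2 * ℓ) , 1 , λ r 1≤r s ∣s∣≡2r periodic τ≤εr →
    anagramish-path-of-balanced φ* ℓ r 1≤r s ∣s∣≡2r periodic (t≤[1/n]*r⇒t*n≤r (2 * ℓ) (τ c L r s) r τ≤εr)
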